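{- Let $\gamma$ be a unary partial graph with $\mathit{cycles}\ \gamma\subseteq\mathit{loops}\ \gamma$, let $x\in\mathit{nodes}\ \gamma$ and $y\notin\mathit{nodes}\ \gamma$. Then the graph $\gamma'$ obtained from $\gamma$ by changing the successor of $x$ to $y$ (all else unchanged) also satisfies $\mathit{cycles}\ \gamma'\subseteq\mathit{loops}\ \gamma'$.
   Context: A partial graph is a finite partial map $\gamma$ from nodes (natural numbers, undefined at $0$) to pairs (contents, adjacency list of nodes); $\mathit{nodes}\ \gamma$ is its domain, $\gamma_{adj}\,x$ the adjacency list (entries need not be in $\mathit{nodes}\ \gamma$). A unary graph has adjacency lists of exactly one element (the successor). $\gamma\setminus x$ is $\gamma$ restricted to $\mathit{nodes}\ \gamma\setminus\{x\}$. $\mathit{reach}\ \gamma\ x=\{x\}\cup\bigcup_{z\in\gamma_{adj}x}\mathit{reach}\ (\gamma\setminus x)\ z$ if $x\in\mathit{nodes}\ \gamma$, else $\emptyset$. $\mathit{cycles}\ \gamma=\{x\mid x\in\bigcup_{y\in\gamma_{adj}x}\mathit{reach}\ \gamma\ y\}$; $\mathit{loops}\ \gamma=\{x\in\mathit{nodes}\ \gamma\mid x\in\gamma_{adj}\,x\}$. -}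

module Defs where

open import Data.Nat using (ℕ; _≤_; _≟_)
open import Data.Maybe using (Maybe; just; nothing)
open import Data.Product using (Σ; ∃; _×_; _,_; proj₁; proj₂)
open import Data.List using (List; []; [_])
open import Data.List.Membership.Propositional using (_∈_)
open import Relation.Nullary using (¬_; yes; no)
open import Relation.Binary.PropositionalEquality using (_≡_; refl)

-- A partial graph with node contents in A: a finite partial map from
-- nodes (natural numbers) to (contents, adjacency list), undefined at 0.
record PGraph (A : Set) : Set where
  field
    at     : ℕ → Maybe (A × List ℕ)
    at0    : at 0 ≡ nothing
    finite : ∃ λ N → ∀ n → N ≤ n → at n ≡ nothing
open PGraph public

_∈nodes_ : {A : Set} → ℕ → PGraph A → Set
x ∈nodes γ = ∃ λ v → at γ x ≡ just v

adj : {A : Set} → PGraph A → ℕ → List ℕ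
adj γ x with at γ x
... | just (_ , l) = l
... | nothing = []

Unary : {A : Set} → PGraph A → Set
Unary γ = ∀ x c l → at γ x ≡ just (c , l) → ∃ λ s → l ≡ [ s ]

private
  restrictAt : {A : Set} → PGraph A → ℕ → ℕ → Maybe (A × List ℕ)
  restrictAt γ x n with n ≟ x
  ... | yes _ = nothing
  ... | no _ = at γ n

  restrict0 : {A : Set} (γ : PGraph A) (x : ℕ) → restrictAt γ x 0 ≡ nothing
  restrict0 γ x with 0 ≟ x
  ... | yes _ = refl
  ... | no _ = at0 γ

  restrictFin : {A : Set} (γ : PGraph A) (x : ℕ) → ∃ λ N → ∀ n → N ≤ n → restrictAt γ x n ≡ nothing
  restrictFin γ x with finite γ
  ... | N , f = N , g
    where
    g : ∀ n → N ≤ n → restrictAt γ x n ≡ nothing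
    g n le with n ≟ x
    ... | yes _ = refl
    ... | no _ = f n le

_∖_ : {A : Set} → PGraph A → ℕ → PGraph A
γ ∖ x = record { at = restrictAt γ x ; at0 = restrict0 γ x ; finite = restrictFin γ x }

-- reach γ x, written out as an inductive membership relation:
-- z ∈ reach γ x  iff  x ∈ nodes γ and (z = x or z ∈ reach (γ ∖ x) w for some w ∈ γ_adj x)
data _∈reach_from_ {A : Set} : ℕ → PGraph A → ℕ → Set where
  here : ∀ {γ x} → x ∈nodes γ → x ∈reach γ from x
  step : ∀ {γ x w z} → x ∈nodes γ → w ∈ adj γ x → z ∈reach (γ ∖ x) from w → z ∈reach γ from x

_∈cycles_ : {A : Set} → ℕ → PGraph A → Set
x ∈cycles γ = ∃ λ y → y ∈ adj γ x × x ∈reach γ from y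

_∈loops_ : {A : Set} → ℕ → PGraph A → Set
x ∈loops γ = x ∈nodes γ × x ∈ adj γ x

CyclesAreLoops : {A : Set} → PGraph A → Set
CyclesAreLoops γ = ∀ x → x ∈cycles γ → x ∈loops γ

private
  setAt : {A : Set} → PGraph A → ℕ → ℕ → ℕ → Maybe (A × List ℕ)
  setAt γ x y n with n ≟ x
  ... | no _ = at γ n
  ... | yes _ with at γ n
  ...   | nothing = nothing
  ...   | just (c , _) = just (c , [ y ])

  set0 : {A : Set} (γ : PGraph A) (x y : ℕ) → setAt γ x y 0 ≡ nothing
  set0 γ x y with 0 ≟ x
  ... | no _ = at0 γ
  ... | yes _ with at γ 0 | at0 γ
  ...   | nothing | _ = refl

  setFin : {A : Set} (γ : PGraph A) (x y : ℕ) → ∃ λ N → ∀ n → N ≤ n → setAt γ x y n ≡ nothing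
  setFin γ x y with finite γ
  ... | N , f = N , g
    where
    g : ∀ n → N ≤ n → setAt γ x y n ≡ nothing
    g n le with n ≟ x
    ... | no _ = f n le
    ... | yes _ with at γ n | f n le
    ...   | nothing | _ = refl

setSucc : {A : Set} → PGraph A → ℕ → ℕ → PGraph A
setSucc γ x y = record { at = setAt γ x y ; at0 = set0 γ x y ; finite = setFin γ x y }

-- The new successor y of x is not a node, so no path of γ' can leave x: a cycle of γ' through
-- x is impossible, and a cycle through any other node z already is a cycle of γ, where it is
-- a loop; the successor of z is unchanged, so it is a loop of γ' as well.
module Submission where

open import Defs
open import Data.Nat using (ℕ; _≟_)
open import Data.Maybe using (just)
open import Data.Product using (_,_)
open import Data.List using ([_])
open import Data.List.Membership.Propositional using (_∈_)
open import Data.List.Relation.Unary.Any using (here)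
open import Data.Empty using (⊥-elim)
open import Relation.Nullary using (¬_; yes; no)
open import Relation.Binary.PropositionalEquality using (_≡_; _≢_; refl; sym; trans; subst)

private
  variable
    A : Set
    γ : PGraph A
    n w x y z : ℕ

AgreeOutside : ℕ → PGraph A → PGraph A → Set
AgreeOutside x γ δ = ∀ n → n ≢ x → at γ n ≡ at δ n

SuccessorsOutside : PGraph A → ℕ → Set
SuccessorsOutside γ x = ∀ v → v ∈ adj γ x → ¬ (v ∈nodes γ)

adj-cong : (γ δ : PGraph A) (n : ℕ) → at γ n ≡ at δ n → adj γ n ≡ adj δ n
adj-cong γ δ n eq rewrite eq = refl

∈nodes-cong : (γ δ : PGraph A) (n : ℕ) → at γ n ≡ at δ n → n ∈nodes γ → n ∈nodes δ
∈nodes-cong γ δ n eq (v , at≡v) = v , trans (sym eq) at≡v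

reach-source-∈nodes : z ∈reach γ from w → w ∈nodes γ
reach-source-∈nodes (here w∈) = w∈
reach-source-∈nodes (step w∈ _ _) = w∈

restrict-∈nodes : (γ : PGraph A) (w n : ℕ) → n ∈nodes (γ ∖ w) → n ∈nodes γ
restrict-∈nodes γ w n (v , at≡v) with n ≟ w
... | no _ = v , at≡v

restrict-adj-⊆ : (γ : PGraph A) → y ∈ adj (γ ∖ w) n → y ∈ adj γ n
restrict-adj-⊆ {w = w} {n = n} γ y∈ with n ≟ w
... | no _ = y∈

restrict-agree : (γ δ : PGraph A) → AgreeOutside x γ δ → AgreeOutside x (γ ∖ w) (δ ∖ w)
restrict-agree {w = w} γ δ agree n n≢x with n ≟ w
... | yes _ = refl
... | no _  = agree n n≢x

restrict-successorsOutside : (γ : PGraph A) → SuccessorsOutside γ x → SuccessorsOutside (γ ∖ w) x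
restrict-successorsOutside γ outside v v∈ v∈nodes =
  outside v (restrict-adj-⊆ γ v∈) (restrict-∈nodes γ _ v v∈nodes)

-- A path that enters x cannot continue, so a path ending elsewhere never visits x.
reach-transfer : (γ δ : PGraph A) → AgreeOutside x γ δ → SuccessorsOutside γ x →
                 z ≢ x → z ∈reach γ from w → z ∈reach δ from w
reach-transfer γ δ agree outside z≢x (here z∈) = here (∈nodes-cong γ δ _ (agree _ z≢x) z∈)
reach-transfer {x = x} {w = w} γ δ agree outside z≢x (step w∈ u∈ r) with w ≟ x
... | yes refl = ⊥-elim (outside _ u∈ (restrict-∈nodes γ w _ (reach-source-∈nodes r)))
... | no w≢x   =
  step (∈nodes-cong γ δ w (agree w w≢x) w∈)
       (subst (_ ∈_) (adj-cong γ δ w (agree w w≢x)) u∈)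
       (reach-transfer (γ ∖ w) (δ ∖ w) (restrict-agree γ δ agree)
                       (restrict-successorsOutside γ outside) z≢x r)

successorsOutside⇒∉cycles : SuccessorsOutside γ x → ¬ (x ∈cycles γ)
successorsOutside⇒∉cycles outside (w , w∈ , r) = outside w w∈ (reach-source-∈nodes r)

cycles-transfer : (γ δ : PGraph A) → AgreeOutside x γ δ → SuccessorsOutside γ x →
                  z ≢ x → z ∈cycles γ → z ∈cycles δ
cycles-transfer γ δ agree outside z≢x (w , w∈ , r) =
  w , subst (w ∈_) (adj-cong γ δ _ (agree _ z≢x)) w∈ , reach-transfer γ δ agree outside z≢x r

loops-transfer : (γ δ : PGraph A) → AgreeOutside x γ δ → z ≢ x → z ∈loops γ → z ∈loops δ
loops-transfer {z = z} γ δ agree z≢x (z∈ , z∈adj) =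
  ∈nodes-cong γ δ z (agree z z≢x) z∈ , subst (z ∈_) (adj-cong γ δ z (agree z z≢x)) z∈adj

cyclesAreLoops-transfer : (γ δ : PGraph A) → AgreeOutside x γ δ → SuccessorsOutside γ x →
                          CyclesAreLoops δ → CyclesAreLoops γ
cyclesAreLoops-transfer {x = x} γ δ agree outside δ-ok z z∈cycles with z ≟ x
... | yes refl = ⊥-elim (successorsOutside⇒∉cycles outside z∈cycles)
... | no z≢x   =
  loops-transfer δ γ (λ n n≢x → sym (agree n n≢x)) z≢x
                 (δ-ok z (cycles-transfer γ δ agree outside z≢x z∈cycles))

setSucc-agree : (γ : PGraph A) → AgreeOutside x (setSucc γ x y) γ
setSucc-agree {x = x} γ n n≢x with n ≟ x
... | yes n≡x = ⊥-elim (n≢x n≡x)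
... | no _    = refl

setSucc-∈nodes : (γ : PGraph A) → n ∈nodes setSucc γ x y → n ∈nodes γ
setSucc-∈nodes {n = n} {x = x} γ (v , at≡v) with n ≟ x
... | no _ = v , at≡v
... | yes _ with at γ n
...   | just u = u , refl

setSucc-adj : (γ : PGraph A) → x ∈nodes γ → adj (setSucc γ x y) x ≡ [ y ]
setSucc-adj {x = x} γ ((c , l) , at≡) with x ≟ x
... | no x≢x = ⊥-elim (x≢x refl)
... | yes _ with at γ x | at≡
...   | just _ | refl = refl

setSucc-successorsOutside : (γ : PGraph A) → x ∈nodes γ → ¬ (y ∈nodes γ) →
                            SuccessorsOutside (setSucc γ x y) x
setSucc-successorsOutside γ x∈ y∉ v v∈ v∈nodes
  with subst (v ∈_) (setSucc-adj γ x∈) v∈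
... | here refl = y∉ (setSucc-∈nodes γ v∈nodes)

lemmaE5 : {A : Set} (γ : PGraph A) (x y : ℕ) →
          Unary γ → CyclesAreLoops γ → x ∈nodes γ → ¬ (y ∈nodes γ) →
          CyclesAreLoops (setSucc γ x y)
lemmaE5 γ x y _ γ-ok x∈ y∉ =
  cyclesAreLoops-transfer (setSucc γ x y) γ (setSucc-agree γ)
                          (setSucc-successorsOutside γ x∈ y∉) γ-ok
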